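{- $\mathrm{ex}(n,\{\text{swords},\text{bat},\text{ears},\text{david}\})\in\Theta(n^2)$.
   Context: Let $P$ be a set of $n$ points in convex position in the plane (the vertices of a convex $n$-gon); a triangle on $P$ is a 3-element subset of $P$. For two distinct triangles $t_1,t_2$ on $P$, label each point of $t_1\cup t_2$ by the triangle(s) containing it and read the points in their cyclic order around the polygon. The pair forms exactly one of eight configurations. (i) If $t_1,t_2$ share two vertices $u,v$: "taco" if their third vertices lie on the same side of the line $uv$, "mariposa" if on opposite sides. (ii) If they share exactly one vertex $v$: read the remaining four vertices in cyclic order starting just after $v$; "bat" if the pattern is $t_1t_1t_2t_2$ or $t_2t_2t_1t_1$, "nested" if it is $t_1t_2t_2t_1$ or $t_2t_1t_1t_2$, "crossing" if it is $t_1t_2t_1t_2$ or $t_2t_1t_2t_1$. (iii) If they share no vertex, the cyclic sequence of the six labels is, up to rotation, reflection and exchanging the roles of $t_1,t_2$, one of: "ears" $AAABBB$, "swords" $AABABB$, "david" $ABABAB$. For a set $X$ of configurations, $\mathrm{ex}(n,X)$ is the maximum size of a family of triangles on $P$ in which no two triangles form a configuration belonging to $X$ (this depends only on $n$ and $X$). -}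

module Defs where

open import Data.Nat using (ℕ; zero; suc; _*_; _≤_)
open import Data.Bool using (Bool; true; false)
open import Data.List using (List; []; _∷_; _++_; drop; take; reverse; map; length)
open import Data.List.Membership.Propositional using (_∈_)
open import Data.List.Relation.Unary.All using (All)
open import Data.List.Relation.Unary.Unique.Propositional using (Unique)
open import Data.Vec using (Vec; []; _∷_)
open import Data.Fin.Subset using (Subset; Side; inside; outside; ∣_∣)
open import Data.Product using (Σ; ∃; _×_; _,_)
open import Data.Sum using (_⊎_)
open import Relation.Binary.PropositionalEquality using (_≡_; _≢_)
open import Relation.Nullary using (¬_)

-- Points of P are Fin n, numbered 0,…,n-1 in cyclic order around the polygon.
-- A triangle on P is a subset of Fin n of cardinality 3.
IsTriangle : {n : ℕ} → Subset n → Set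
IsTriangle t = ∣ t ∣ ≡ 3

data Label : Set where
  one two both : Label

labels : {n : ℕ} → Subset n → Subset n → List Label
labels [] [] = []
labels (inside  ∷ s) (inside  ∷ t) = both ∷ labels s t
labels (inside  ∷ s) (outside ∷ t) = one  ∷ labels s t
labels (outside ∷ s) (inside  ∷ t) = two  ∷ labels s t
labels (outside ∷ s) (outside ∷ t) = labels s t

rot : {A : Set} → ℕ → List A → List A
rot k w = drop k w ++ take k w

swapL : Label → Label
swapL one = two
swapL two = one
swapL both = both

RotEq : List Label → List Label → Set
RotEq w p = ∃ λ k → rot k w ≡ p

SymEq : List Label → List Label → Set
SymEq w p = RotEq w p ⊎ RotEq (reverse w) p ⊎ RotEq (map swapL w) p
          ⊎ RotEq (reverse (map swapL w)) p

data Config : Set where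
  taco mariposa bat nested crossing ears swords david : Config

-- Two shared vertices u,v: third vertices on the same side of uv iff the
-- cyclic word is (both both x y); opposite sides iff (both x both y).
-- One shared vertex v: rotate the word so that v comes first and read the
-- remaining four labels.
Forms : {n : ℕ} → Subset n → Subset n → Config → Set
Forms t₁ t₂ taco     = RotEq (labels t₁ t₂) (both ∷ both ∷ one ∷ two ∷ [])
                     ⊎ RotEq (labels t₁ t₂) (both ∷ both ∷ two ∷ one ∷ [])
Forms t₁ t₂ mariposa = RotEq (labels t₁ t₂) (both ∷ one ∷ both ∷ two ∷ [])
                     ⊎ RotEq (labels t₁ t₂) (both ∷ two ∷ both ∷ one ∷ [])
Forms t₁ t₂ bat      = RotEq (labels t₁ t₂) (both ∷ one ∷ one ∷ two ∷ two ∷ [])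
                     ⊎ RotEq (labels t₁ t₂) (both ∷ two ∷ two ∷ one ∷ one ∷ [])
Forms t₁ t₂ nested   = RotEq (labels t₁ t₂) (both ∷ one ∷ two ∷ two ∷ one ∷ [])
                     ⊎ RotEq (labels t₁ t₂) (both ∷ two ∷ one ∷ one ∷ two ∷ [])
Forms t₁ t₂ crossing = RotEq (labels t₁ t₂) (both ∷ one ∷ two ∷ one ∷ two ∷ [])
                     ⊎ RotEq (labels t₁ t₂) (both ∷ two ∷ one ∷ two ∷ one ∷ [])
Forms t₁ t₂ ears     = SymEq (labels t₁ t₂) (one ∷ one ∷ one ∷ two ∷ two ∷ two ∷ [])
Forms t₁ t₂ swords   = SymEq (labels t₁ t₂) (one ∷ one ∷ two ∷ one ∷ two ∷ two ∷ [])
Forms t₁ t₂ david    = SymEq (labels t₁ t₂) (one ∷ two ∷ one ∷ two ∷ one ∷ two ∷ [])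

IsFamily : (n : ℕ) → List (Subset n) → Set
IsFamily n F = All IsTriangle F × Unique F

Avoids : {n : ℕ} → List Config → List (Subset n) → Set
Avoids X F = ∀ {t₁ t₂} → t₁ ∈ F → t₂ ∈ F → t₁ ≢ t₂ →
             ∀ c → Forms t₁ t₂ c → ¬ (c ∈ X)

exAtLeast : ℕ → List Config → ℕ → Set
exAtLeast n X m = Σ (List (Subset n)) λ F → IsFamily n F × Avoids X F × m ≤ length F

exAtMost : ℕ → List Config → ℕ → Set
exAtMost n X m = ∀ (F : List (Subset n)) → IsFamily n F → Avoids X F → length F ≤ m

X18 : List Config
X18 = swords ∷ bat ∷ ears ∷ david ∷ []

module Submission where

-- Two disjoint triangles always form ears, swords or david
-- (their six labels are three 1s and three 2s, and each of the twenty such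
-- words is checked by a verified search to be one of the three patterns up
-- to symmetry).  Hence in an admissible family every two triangles share a
-- vertex, so all of them meet a fixed member t₀.  The number of 3-subsets
-- meeting a set s is at most |s|·n², and a duplicate-free family contained
-- in a list is no longer than that list, giving at most 3n² triangles.
--
-- Split the points 1,…,n-1 into two consecutive arcs of sizes
-- k ≤ r ≤ k+1 and take the k·r "fan" triangles formed by point 0 and one
-- point of each arc.  Two fan triangles share point 0, so they cannot form
-- ears, swords or david (which have no shared point), and they cannot form
-- a bat, since after point 0 each arc contributes one point of each
-- triangle.  Finally n² ≤ (4k)(4r) = 16kr.

open import Defs
open import Data.Nat using (ℕ; zero; suc; _+_; _*_; _^_; _≤_; z≤n; s≤s)
open import Data.Nat.Properties
  using ( suc-injective; +-suc; m≤n+m; ≤-trans; ≤-reflexive; +-mono-≤; +-monoʳ-≤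
        ; *-monoʳ-≤; *-mono-≤; *-identityʳ; +-identityʳ; *-distribˡ-+; ^-monoˡ-≤; n≤1+n
        ; 0≢1+n; n≮0; +-comm; <-irrefl; module ≤-Reasoning)
open import Data.Nat.Tactic.RingSolver using (solve-∀)
open import Data.List
  using ( List; []; _∷_; _++_; map; reverse; length; filter; drop; take
        ; allFin; cartesianProductWith)
open import Data.List.Properties
  using (≡-dec; length-++; length-map; length-tabulate; ++-identityʳ; take++drop≡id; ∷-injectiveʳ)
open import Data.List.Membership.Propositional using (_∈_; _∉_)
open import Data.List.Membership.Propositional.Properties
  using (∈-map⁺; ∈-++⁺ˡ; ∈-++⁺ʳ; ∈-++⁻; ∈-∃++; ∈-cartesianProductWith⁻)
open import Data.List.Relation.Unary.Any using (here; there)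
open import Data.List.Relation.Unary.All as All using (All; []; _∷_)
open import Data.List.Relation.Unary.Unique.Propositional using (Unique)
open import Data.List.Relation.Unary.AllPairs using (_∷_)
import Data.List.Relation.Unary.Unique.Propositional.Properties as Unique
open import Data.List.Relation.Binary.Permutation.Propositional using (_↭_; ↭-trans; ↭-reflexive)
open import Data.List.Relation.Binary.Permutation.Propositional.Properties
  using (↭-length; filter-↭; ↭-reverse; ++-comm)
open import Data.Maybe using (Maybe; just; nothing; _<∣>_; from-just)
import Data.Maybe as Maybe
open import Data.Maybe.Effectful using (applicative)
open import Data.Vec using ([]; _∷_) renaming (_++_ to _++ᵥ_)
open import Data.Vec.Properties using (++-injective) renaming (∷-injective to ∷-injectiveᵥ)
open import Data.Fin using (Fin)
open import Data.Fin.Subset using (Subset; inside; outside; ∣_∣; ⁅_⁆) renaming (_∈_ to _∈ₛ_)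
open import Data.Fin.Subset.Properties using (∣⁅x⁆∣≡1; x∈⁅x⁆; x∈⁅y⁆⇒x≡y)
open import Data.Product using (Σ; ∃₂; _×_; _,_; proj₂)
open import Data.Sum using (_⊎_; inj₁; inj₂)
open import Data.Empty using (⊥; ⊥-elim)
open import Function using (_∘_; id)
open import Level using (0ℓ)
open import Relation.Binary.Definitions using (DecidableEquality)
open import Relation.Binary.PropositionalEquality
open import Relation.Nullary using (¬_; yes; no)
open import Relation.Nullary.Decidable using (from-no)

private variable
  n k r : ℕ

_≟_ : DecidableEquality Label
one  ≟ one  = yes refl
one  ≟ two  = no λ ()
one  ≟ both = no λ ()
two  ≟ one  = no λ ()
two  ≟ two  = yes refl
two  ≟ both = no λ ()
both ≟ one  = no λ ()
both ≟ two  = no λ ()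
both ≟ both = yes refl

open import Data.List.Membership.DecPropositional _≟_ using (_∈?_)

occ : Label → List Label → ℕ
occ ℓ w = length (filter (_≟ ℓ) w)

occ-↭ : ∀ ℓ {w w′} → w ↭ w′ → occ ℓ w ≡ occ ℓ w′
occ-↭ ℓ w↭w′ = ↭-length (filter-↭ (_≟ ℓ) w↭w′)

rot-↭ : ∀ j (w : List Label) → rot j w ↭ w
rot-↭ j w = ↭-trans (++-comm (drop j w) (take j w)) (↭-reflexive (take++drop≡id j w))

occ-rot : ∀ ℓ {w p} → RotEq w p → occ ℓ w ≡ occ ℓ p
occ-rot ℓ {w} (j , refl) = sym (occ-↭ ℓ (rot-↭ j w))

occ-both-swap : ∀ w → occ both (map swapL w) ≡ occ both w
occ-both-swap []         = refl
occ-both-swap (one  ∷ w) = occ-both-swap w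
occ-both-swap (two  ∷ w) = occ-both-swap w
occ-both-swap (both ∷ w) = cong suc (occ-both-swap w)

occ-both-sym : ∀ {w p} → SymEq w p → occ both w ≡ occ both p
occ-both-sym (inj₁ e) = occ-rot both e
occ-both-sym {w} (inj₂ (inj₁ e)) = trans (sym (occ-↭ both (↭-reverse w))) (occ-rot both e)
occ-both-sym {w} (inj₂ (inj₂ (inj₁ e))) = trans (sym (occ-both-swap w)) (occ-rot both e)
occ-both-sym {w} (inj₂ (inj₂ (inj₂ e))) =
  trans (sym (occ-both-swap w))
        (trans (sym (occ-↭ both (↭-reverse (map swapL w)))) (occ-rot both e))

rot-fixes-head : ∀ {x y} → both ∉ y → RotEq (both ∷ x) (both ∷ y) → x ≡ y
rot-fixes-head {x} _ (zero , e) = trans (sym (++-identityʳ x)) (∷-injectiveʳ e)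
rot-fixes-head {x} {y} both∉y (suc j , e) with drop j x in d
... | []     = begin
  x                    ≡⟨ take++drop≡id j x ⟨
  take j x ++ drop j x ≡⟨ cong (take j x ++_) d ⟩
  take j x ++ []       ≡⟨ ++-identityʳ (take j x) ⟩
  take j x             ≡⟨ ∷-injectiveʳ e ⟩
  y                    ∎
  where open ≡-Reasoning
... | _ ∷ zs = ⊥-elim (both∉y (subst (both ∈_) (∷-injectiveʳ e) (∈-++⁺ʳ zs (here refl))))

ears-word swords-word david-word : List Label
ears-word   = one ∷ one ∷ one ∷ two ∷ two ∷ two ∷ []
swords-word = one ∷ one ∷ two ∷ one ∷ two ∷ two ∷ []
david-word  = one ∷ two ∷ one ∷ two ∷ one ∷ two ∷ []

DisjointConfig : List Label → Set
DisjointConfig w = SymEq w ears-word ⊎ SymEq w swords-word ⊎ SymEq w david-word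

words : ℕ → ℕ → List (List Label)
words zero    zero    = [] ∷ []
words zero    (suc b) = map (two ∷_) (words zero b)
words (suc a) zero    = map (one ∷_) (words a zero)
words (suc a) (suc b) = map (one ∷_) (words a (suc b)) ++ map (two ∷_) (words (suc a) b)

words-complete : ∀ {a b} w → occ one w ≡ a → occ two w ≡ b → occ both w ≡ 0 → w ∈ words a b
words-complete []                        refl refl _ = here refl
words-complete {zero}          (one ∷ w) ()   _    _
words-complete {suc a} {zero}  (one ∷ w) p    q    s =
  ∈-map⁺ (one ∷_) (words-complete w (suc-injective p) q s)
words-complete {suc a} {suc b} (one ∷ w) p    q    s =
  ∈-++⁺ˡ (∈-map⁺ (one ∷_) (words-complete w (suc-injective p) q s))
words-complete {_}     {zero}  (two ∷ w) _    ()   _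
words-complete {zero}  {suc b} (two ∷ w) p    q    s =
  ∈-map⁺ (two ∷_) (words-complete w p (suc-injective q) s)
words-complete {suc a} {suc b} (two ∷ w) p    q    s =
  ∈-++⁺ʳ (map (one ∷_) (words a (suc b))) (∈-map⁺ (two ∷_) (words-complete w p (suc-injective q) s))
words-complete                 (both ∷ w) _   _    ()

find-rotation : (w p : List Label) → ℕ → Maybe (RotEq w p)
find-rotation w p zero    = nothing
find-rotation w p (suc j) with ≡-dec _≟_ (rot j w) p
... | yes e = just (j , e)
... | no _  = find-rotation w p j

sym-eq? : (w p : List Label) → Maybe (SymEq w p)
sym-eq? w p = Maybe.map inj₁ (rot? w)
          <∣> Maybe.map (inj₂ ∘ inj₁) (rot? (reverse w))
          <∣> Maybe.map (inj₂ ∘ inj₂ ∘ inj₁) (rot? (map swapL w))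
          <∣> Maybe.map (inj₂ ∘ inj₂ ∘ inj₂) (rot? (reverse (map swapL w)))
  where
  rot? : (v : List Label) → Maybe (RotEq v p)
  rot? v = find-rotation v p (length v)

disjoint-config? : (w : List Label) → Maybe (DisjointConfig w)
disjoint-config? w = Maybe.map inj₁ (sym-eq? w ears-word)
                 <∣> Maybe.map (inj₂ ∘ inj₁) (sym-eq? w swords-word)
                 <∣> Maybe.map (inj₂ ∘ inj₂) (sym-eq? w david-word)

-- Each of the twenty words with three 1s and three 2s is ears, swords or david
-- (the search succeeds on all of them, which Agda verifies by evaluation).
all-disjoint-configs : All DisjointConfig (words 3 3)
all-disjoint-configs =
  from-just (All.sequenceA 0ℓ applicative (All.universal disjoint-config? (words 3 3)))

shared : Subset n → Subset n → ℕ
shared s t = occ both (labels s t)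

labels-one : (s t : Subset n) → occ one (labels s t) + shared s t ≡ ∣ s ∣
labels-one []            []            = refl
labels-one (inside  ∷ s) (inside  ∷ t) = trans (+-suc _ _) (cong suc (labels-one s t))
labels-one (inside  ∷ s) (outside ∷ t) = cong suc (labels-one s t)
labels-one (outside ∷ s) (inside  ∷ t) = labels-one s t
labels-one (outside ∷ s) (outside ∷ t) = labels-one s t

labels-two : (s t : Subset n) → occ two (labels s t) + shared s t ≡ ∣ t ∣
labels-two []            []            = refl
labels-two (inside  ∷ s) (inside  ∷ t) = trans (+-suc _ _) (cong suc (labels-two s t))
labels-two (inside  ∷ s) (outside ∷ t) = labels-two s t
labels-two (outside ∷ s) (inside  ∷ t) = cong suc (labels-two s t)
labels-two (outside ∷ s) (outside ∷ t) = labels-two s t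

shared-self : (t : Subset n) → shared t t ≡ ∣ t ∣
shared-self []            = refl
shared-self (inside  ∷ t) = cong suc (shared-self t)
shared-self (outside ∷ t) = shared-self t

shared≤ : (t s : Subset n) → shared t s ≤ ∣ t ∣
shared≤ t s = ≤-trans (m≤n+m (shared t s) (occ one (labels t s))) (≤-reflexive (labels-one t s))

labels-++ : (u₁ u₂ : Subset k) (v₁ v₂ : Subset r) →
            labels (u₁ ++ᵥ v₁) (u₂ ++ᵥ v₂) ≡ labels u₁ u₂ ++ labels v₁ v₂
labels-++ []            []            v₁ v₂ = refl
labels-++ (inside  ∷ u₁) (inside  ∷ u₂) v₁ v₂ = cong (both ∷_) (labels-++ u₁ u₂ v₁ v₂)
labels-++ (inside  ∷ u₁) (outside ∷ u₂) v₁ v₂ = cong (one ∷_) (labels-++ u₁ u₂ v₁ v₂)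
labels-++ (outside ∷ u₁) (inside  ∷ u₂) v₁ v₂ = cong (two ∷_) (labels-++ u₁ u₂ v₁ v₂)
labels-++ (outside ∷ u₁) (outside ∷ u₂) v₁ v₂ = labels-++ u₁ u₂ v₁ v₂

card-++ : (u : Subset k) (v : Subset r) → ∣ u ++ᵥ v ∣ ≡ ∣ u ∣ + ∣ v ∣
card-++ []            v = refl
card-++ (inside  ∷ u) v = cong suc (card-++ u v)
card-++ (outside ∷ u) v = card-++ u v

choose : (n k : ℕ) → List (Subset n)
choose zero    zero    = [] ∷ []
choose zero    (suc k) = []
choose (suc n) zero    = map (outside ∷_) (choose n zero)
choose (suc n) (suc k) = map (inside ∷_) (choose n k) ++ map (outside ∷_) (choose n (suc k))

meeting : Subset n → ℕ → List (Subset n)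
meeting s             zero    = []
meeting []            (suc k) = []
meeting {suc n} (inside  ∷ s) (suc k) =
  map (inside ∷_) (choose n k) ++ map (outside ∷_) (meeting s (suc k))
meeting (outside ∷ s) (suc k) =
  map (inside ∷_) (meeting s k) ++ map (outside ∷_) (meeting s (suc k))

length-map-++ : ∀ {A B : Set} (f g : A → B) (xs ys : List A) →
                length (map f xs ++ map g ys) ≡ length xs + length ys
length-map-++ f g xs ys =
  trans (length-++ (map f xs)) (cong₂ _+_ (length-map f xs) (length-map g ys))

choose-complete : (t : Subset n) → ∣ t ∣ ≡ k → t ∈ choose n k
choose-complete {k = zero}  []            _  = here refl
choose-complete {k = suc k} []            ()
choose-complete {k = zero}  (inside  ∷ t) ()
choose-complete {k = zero}  (outside ∷ t) e  = ∈-map⁺ (outside ∷_) (choose-complete t e)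
choose-complete {k = suc k} (inside  ∷ t) e  =
  ∈-++⁺ˡ (∈-map⁺ (inside ∷_) (choose-complete t (suc-injective e)))
choose-complete {suc n} {suc k} (outside ∷ t) e =
  ∈-++⁺ʳ (map (inside ∷_) (choose n k)) (∈-map⁺ (outside ∷_) (choose-complete t e))

choose-length : ∀ n k → length (choose n k) ≤ n ^ k
choose-length zero    zero    = ≤-reflexive refl
choose-length zero    (suc k) = z≤n
choose-length (suc n) zero    =
  ≤-trans (≤-reflexive (length-map (outside ∷_) (choose n zero))) (choose-length n zero)
choose-length (suc n) (suc k) = begin
  length (map (inside ∷_) (choose n k) ++ map (outside ∷_) (choose n (suc k)))
    ≡⟨ length-map-++ (inside ∷_) (outside ∷_) (choose n k) (choose n (suc k)) ⟩
  length (choose n k) + length (choose n (suc k))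
    ≤⟨ +-mono-≤ (choose-length n k) (choose-length n (suc k)) ⟩
  n ^ k + n * n ^ k
    ≤⟨ +-mono-≤ (^-monoˡ-≤ k (n≤1+n n)) (*-monoʳ-≤ n (^-monoˡ-≤ k (n≤1+n n))) ⟩
  suc n ^ suc k ∎
  where open ≤-Reasoning

meeting-complete : (t s : Subset n) → ∣ t ∣ ≡ k → 1 ≤ shared t s → t ∈ meeting s k
meeting-complete {k = zero} t s e h =
  ⊥-elim (n≮0 (≤-trans h (≤-trans (shared≤ t s) (≤-reflexive e))))
meeting-complete {k = suc k} (inside  ∷ t) (inside  ∷ s) e h =
  ∈-++⁺ˡ (∈-map⁺ (inside ∷_) (choose-complete t (suc-injective e)))
meeting-complete {k = suc k} (inside  ∷ t) (outside ∷ s) e h =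
  ∈-++⁺ˡ (∈-map⁺ (inside ∷_) (meeting-complete t s (suc-injective e) h))
meeting-complete {suc n} {suc k} (outside ∷ t) (inside  ∷ s) e h =
  ∈-++⁺ʳ (map (inside ∷_) (choose n k)) (∈-map⁺ (outside ∷_) (meeting-complete t s e h))
meeting-complete {k = suc k} (outside ∷ t) (outside ∷ s) e h =
  ∈-++⁺ʳ (map (inside ∷_) (meeting s k)) (∈-map⁺ (outside ∷_) (meeting-complete t s e h))

meeting-length : (s : Subset n) (k : ℕ) → length (meeting s (suc k)) ≤ ∣ s ∣ * n ^ k
meeting-length []                    k       = z≤n
meeting-length {suc n} (inside  ∷ s) k       = begin
  length (map (inside ∷_) (choose n k) ++ map (outside ∷_) (meeting s (suc k)))
    ≡⟨ length-map-++ (inside ∷_) (outside ∷_) (choose n k) (meeting s (suc k)) ⟩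
  length (choose n k) + length (meeting s (suc k))
    ≤⟨ +-mono-≤ (choose-length n k) (meeting-length s k) ⟩
  n ^ k + ∣ s ∣ * n ^ k
    ≤⟨ +-mono-≤ (^-monoˡ-≤ k (n≤1+n n)) (*-monoʳ-≤ ∣ s ∣ (^-monoˡ-≤ k (n≤1+n n))) ⟩
  suc ∣ s ∣ * suc n ^ k ∎
  where open ≤-Reasoning
meeting-length {suc n} (outside ∷ s) zero    =
  ≤-trans (≤-reflexive (length-map (outside ∷_) (meeting s 1))) (meeting-length s zero)
meeting-length {suc n} (outside ∷ s) (suc j) = begin
  length (map (inside ∷_) (meeting s (suc j)) ++ map (outside ∷_) (meeting s (suc (suc j))))
    ≡⟨ length-map-++ (inside ∷_) (outside ∷_) (meeting s (suc j)) (meeting s (suc (suc j))) ⟩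
  length (meeting s (suc j)) + length (meeting s (suc (suc j)))
    ≤⟨ +-mono-≤ (meeting-length s j) (meeting-length s (suc j)) ⟩
  ∣ s ∣ * n ^ j + ∣ s ∣ * (n * n ^ j)
    ≤⟨ +-mono-≤ (*-monoʳ-≤ ∣ s ∣ (^-monoˡ-≤ j (n≤1+n n)))
                (*-monoʳ-≤ ∣ s ∣ (*-monoʳ-≤ n (^-monoˡ-≤ j (n≤1+n n)))) ⟩
  ∣ s ∣ * suc n ^ j + ∣ s ∣ * (n * suc n ^ j)
    ≡⟨ *-distribˡ-+ ∣ s ∣ (suc n ^ j) (n * suc n ^ j) ⟨
  ∣ s ∣ * suc n ^ suc j ∎
  where open ≤-Reasoning

unique-⊆-length : ∀ {A : Set} {xs ys : List A} → Unique xs → (∀ {x} → x ∈ xs → x ∈ ys) →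
                  length xs ≤ length ys
unique-⊆-length {xs = []}     _            _   = z≤n
unique-⊆-length {xs = x ∷ xs} {ys} (x∉xs ∷ uxs) xs⊆ys with ∈-∃++ (xs⊆ys (here refl))
... | as , bs , refl = begin
  suc (length xs)            ≤⟨ s≤s (unique-⊆-length uxs xs⊆as++bs) ⟩
  suc (length (as ++ bs))    ≡⟨ cong suc (length-++ as) ⟩
  suc (length as + length bs) ≡⟨ +-suc (length as) (length bs) ⟨
  length as + length (x ∷ bs) ≡⟨ length-++ as ⟨
  length (as ++ x ∷ bs)      ∎
  where
  open ≤-Reasoning
  xs⊆as++bs : ∀ {y} → y ∈ xs → y ∈ as ++ bs
  xs⊆as++bs {y} y∈xs with ∈-++⁻ as (xs⊆ys (there y∈xs))
  ... | inj₁ y∈as          = ∈-++⁺ˡ y∈as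
  ... | inj₂ (here refl)   = ⊥-elim (All.lookup x∉xs y∈xs refl)
  ... | inj₂ (there y∈bs)  = ∈-++⁺ʳ as y∈bs

-- Upper bound

disjoint-triangles : {s t : Subset n} → IsTriangle s → IsTriangle t → shared s t ≡ 0 →
                     DisjointConfig (labels s t)
disjoint-triangles {s = s} {t} s-tri t-tri none =
  All.lookup all-disjoint-configs
    (words-complete (labels s t) (unshared (labels-one s t) s-tri)
                                 (unshared (labels-two s t) t-tri) none)
  where
  unshared : ∀ {m c} → m + shared s t ≡ c → c ≡ 3 → m ≡ 3
  unshared {m} e c≡3 = trans (sym (+-identityʳ m)) (trans (cong (m +_) (sym none)) (trans e c≡3))

intersecting : {F : List (Subset n)} {s t : Subset n} → All IsTriangle F → Avoids X18 F →
               s ∈ F → t ∈ F → 1 ≤ shared s t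
intersecting {s = s} {t} tri avoids s∈F t∈F with shared s t in none
... | suc _ = s≤s z≤n
... | zero  =
  ⊥-elim (forbidden (disjoint-triangles {s = s} {t} (All.lookup tri s∈F) (All.lookup tri t∈F) none))
  where
  distinct : s ≢ t
  distinct refl = 0≢1+n (trans (sym none) (trans (shared-self s) (All.lookup tri s∈F)))
  forbidden : DisjointConfig (labels s t) → ⊥
  forbidden (inj₁ e)        = avoids s∈F t∈F distinct ears   e (there (there (here refl)))
  forbidden (inj₂ (inj₁ e)) = avoids s∈F t∈F distinct swords e (here refl)
  forbidden (inj₂ (inj₂ e)) = avoids s∈F t∈F distinct david  e (there (there (there (here refl))))

-- Every admissible family lies among the at most 3n² triangles meeting its first member.
upper-bound : ∀ n → exAtMost n X18 (3 * (n * n))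
upper-bound n []       _               _      = z≤n
upper-bound n (t₀ ∷ F) (tri , unique) avoids = begin
  length (t₀ ∷ F)       ≤⟨ unique-⊆-length unique meets-t₀ ⟩
  length (meeting t₀ 3) ≤⟨ meeting-length t₀ 2 ⟩
  ∣ t₀ ∣ * n ^ 2        ≡⟨ cong₂ _*_ (All.head tri) (cong (n *_) (*-identityʳ n)) ⟩
  3 * (n * n)           ∎
  where
  open ≤-Reasoning
  meets-t₀ : ∀ {t} → t ∈ t₀ ∷ F → t ∈ meeting t₀ 3
  meets-t₀ t∈F =
    meeting-complete _ t₀ (All.lookup tri t∈F) (intersecting tri avoids t∈F (here refl))

-- Lower bound

-- The fan triangle {0} ∪ {a in the arc 1,…,k} ∪ {b in the arc k+1,…,k+r}.
apex : Fin k → Fin r → Subset (suc (k + r))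
apex a b = inside ∷ (⁅ a ⁆ ++ᵥ ⁅ b ⁆)

fan : ∀ k r → List (Subset (suc (k + r)))
fan k r = cartesianProductWith apex (allFin k) (allFin r)

apex-triangle : (a : Fin k) (b : Fin r) → IsTriangle (apex a b)
apex-triangle a b = cong suc (trans (card-++ ⁅ a ⁆ ⁅ b ⁆) (cong₂ _+_ (∣⁅x⁆∣≡1 a) (∣⁅x⁆∣≡1 b)))

apex-injective : ∀ {a a′ : Fin k} {b b′ : Fin r} → apex a b ≡ apex a′ b′ → a ≡ a′ × b ≡ b′
apex-injective {a = a} {a′} {b} {b′} e with ++-injective ⁅ a ⁆ ⁅ a′ ⁆ (proj₂ (∷-injectiveᵥ e))
... | ea , eb =
  x∈⁅y⁆⇒x≡y a′ (subst (a ∈ₛ_) ea (x∈⁅x⁆ a)) , x∈⁅y⁆⇒x≡y b′ (subst (b ∈ₛ_) eb (x∈⁅x⁆ b))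

length-cartesianProductWith : ∀ {A B C : Set} (f : A → B → C) xs ys →
                              length (cartesianProductWith f xs ys) ≡ length xs * length ys
length-cartesianProductWith f []       ys = refl
length-cartesianProductWith f (x ∷ xs) ys =
  trans (length-++ (map (f x) ys))
        (cong₂ _+_ (length-map (f x) ys) (length-cartesianProductWith f xs ys))

fan-length : ∀ k r → length (fan k r) ≡ k * r
fan-length k r = trans (length-cartesianProductWith apex (allFin k) (allFin r))
                       (cong₂ _*_ (length-tabulate {n = k} id) (length-tabulate {n = r} id))

not-disjoint : ∀ {x p} → occ both p ≡ 0 → ¬ SymEq (both ∷ x) p
not-disjoint p-disjoint e with trans (occ-both-sym e) p-disjoint
... | ()

mixed-prefix : ∀ {ℓ rest} L₁ L₂ → occ one L₁ + occ both L₁ ≡ 1 → occ two L₁ + occ both L₁ ≡ 1 →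
               ℓ ≢ both → L₁ ++ L₂ ≢ ℓ ∷ ℓ ∷ rest
mixed-prefix []                _ () _  _      _
mixed-prefix (one  ∷ [])       _ _  () _      refl
mixed-prefix (two  ∷ [])       _ () _  _      refl
mixed-prefix (both ∷ [])       _ _  _  ℓ≢both refl = ℓ≢both refl
mixed-prefix (one  ∷ one  ∷ _) _ () _  _      refl
mixed-prefix (two  ∷ two  ∷ _) _ _  () _      refl
mixed-prefix (both ∷ both ∷ _) _ _  _  ℓ≢both refl = ℓ≢both refl

-- The pattern of a bat read from the common apex never occurs for two fan
-- triangles: after the apex, the first arc contributes one point of each.
fan-not-bat-pattern : (a a′ : Fin k) (b b′ : Fin r) {ℓ : Label} {rest : List Label} →
                      ℓ ≢ both → both ∉ ℓ ∷ ℓ ∷ rest →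
                      ¬ RotEq (labels (apex a b) (apex a′ b′)) (both ∷ ℓ ∷ ℓ ∷ rest)
fan-not-bat-pattern a a′ b b′ ℓ≢both both∉ e =
  mixed-prefix (labels ⁅ a ⁆ ⁅ a′ ⁆) (labels ⁅ b ⁆ ⁅ b′ ⁆)
               (trans (labels-one ⁅ a ⁆ ⁅ a′ ⁆) (∣⁅x⁆∣≡1 a))
               (trans (labels-two ⁅ a ⁆ ⁅ a′ ⁆) (∣⁅x⁆∣≡1 a′))
               ℓ≢both
               (trans (sym (labels-++ ⁅ a ⁆ ⁅ a′ ⁆ ⁅ b ⁆ ⁅ b′ ⁆)) (rot-fixes-head both∉ e))

fan-pair : (a a′ : Fin k) (b b′ : Fin r) → ∀ c → Forms (apex a b) (apex a′ b′) c → ¬ c ∈ X18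
fan-pair a a′ b b′ _ f (here refl)                         = not-disjoint refl f
fan-pair a a′ b b′ _ (inj₁ f) (there (here refl))          =
  fan-not-bat-pattern a a′ b b′ (λ ()) (from-no (both ∈? one ∷ one ∷ two ∷ two ∷ [])) f
fan-pair a a′ b b′ _ (inj₂ f) (there (here refl))          =
  fan-not-bat-pattern a a′ b b′ (λ ()) (from-no (both ∈? two ∷ two ∷ one ∷ one ∷ [])) f
fan-pair a a′ b b′ _ f (there (there (here refl)))         = not-disjoint refl f
fan-pair a a′ b b′ _ f (there (there (there (here refl)))) = not-disjoint refl f

fan-admissible : ∀ k r → exAtLeast (suc (k + r)) X18 (k * r)
fan-admissible k r =
  fan k r , (All.tabulate triangle , unique) , avoids , ≤-reflexive (sym (fan-length k r))
  where
  triangle : ∀ {t} → t ∈ fan k r → IsTriangle t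
  triangle t∈ with ∈-cartesianProductWith⁻ apex (allFin k) (allFin r) t∈
  ... | a , b , _ , _ , refl = apex-triangle a b
  unique : Unique (fan k r)
  unique = Unique.cartesianProductWith⁺ apex apex-injective (Unique.allFin⁺ k) (Unique.allFin⁺ r)
  avoids : Avoids X18 (fan k r)
  avoids t₁∈ t₂∈ _
    with ∈-cartesianProductWith⁻ apex (allFin k) (allFin r) t₁∈
       | ∈-cartesianProductWith⁻ apex (allFin k) (allFin r) t₂∈
  ... | a , b , _ , _ , refl | a′ , b′ , _ , _ , refl = fan-pair a a′ b b′

balanced-split : ∀ m → ∃₂ λ k r → m ≡ k + r × k ≤ r × r ≤ suc k
balanced-split zero = 0 , 0 , refl , z≤n , z≤n
balanced-split (suc m) with balanced-split m
... | k , r , refl , k≤r , r≤1+k =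
  r , suc k , trans (cong suc (+-comm k r)) (sym (+-suc r k)) , r≤1+k , s≤s k≤r

total≤4k : 1 ≤ k → r ≤ suc k → suc (k + r) ≤ 4 * k
total≤4k {k} {r} 1≤k r≤1+k = begin
  suc (k + r)     ≤⟨ s≤s (+-monoʳ-≤ k r≤1+k) ⟩
  suc (k + suc k) ≡⟨ double k ⟩
  2 * k + 2       ≤⟨ +-monoʳ-≤ (2 * k) (*-monoʳ-≤ 2 1≤k) ⟩
  2 * k + 2 * k   ≡⟨ quadruple k ⟩
  4 * k           ∎
  where
  open ≤-Reasoning
  double : ∀ k → suc (k + suc k) ≡ 2 * k + 2
  double = solve-∀
  quadruple : ∀ k → 2 * k + 2 * k ≡ 4 * k
  quadruple = solve-∀

-- ex(n, X18) ≥ n²/16 for n ≥ 3, witnessed by the fan of a balanced split of n-1.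
lower-bound : ∀ n → 3 ≤ n → Σ ℕ λ m → exAtLeast n X18 m × n * n ≤ 16 * m
lower-bound (suc m) 3≤n with balanced-split m
-- (an empty first arc would force n ≤ 2)
... | zero  , r , refl , _   , r≤1    = ⊥-elim (<-irrefl refl (≤-trans 3≤n (s≤s r≤1)))
... | suc k , r , refl , k≤r , r≤1+k  = suc k * r , fan-admissible (suc k) r , square-bound
  where
  n≤4k : suc (suc k + r) ≤ 4 * suc k
  n≤4k = total≤4k (s≤s z≤n) r≤1+k
  square-bound : suc (suc k + r) * suc (suc k + r) ≤ 16 * (suc k * r)
  square-bound = begin
    suc (suc k + r) * suc (suc k + r) ≤⟨ *-mono-≤ n≤4k (≤-trans n≤4k (*-monoʳ-≤ 4 k≤r)) ⟩
    4 * suc k * (4 * r)               ≡⟨ sixteen (suc k) r ⟩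
    16 * (suc k * r)                  ∎
    where
    open ≤-Reasoning
    sixteen : ∀ k r → 4 * k * (4 * r) ≡ 16 * (k * r)
    sixteen = solve-∀

theorem18 : Σ ℕ λ c → Σ ℕ λ C → Σ ℕ λ n₀ → ∀ n → n₀ ≤ n →
            (Σ ℕ λ m → exAtLeast n X18 m × n * n ≤ c * m) × exAtMost n X18 (C * (n * n))
theorem18 = 16 , 3 , 3 , λ n 3≤n → lower-bound n 3≤n , upper-bound n
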